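{- Let $k\ge 1$ and $n\ge 1$ be integers, let $R=\{c_1,\dots,c_k\}$ be a set of $k$ colors, and let $\Gamma_{k,R}$ be an acyclic $k$-colored digraph with vertex set $[n]=\{1,\dots,n\}$, labeled so that $i<j$ whenever there is an edge from $i$ to $j$. Let $\{x_i^{(t)} : i\in[n],\ t\in[k]\}$ be commuting indeterminates. Define the $n\times n$ matrix $A_{\Gamma_{k,R}}=(a_{ij})$ by $$a_{ij}=\begin{cases} 1+\sum_{t\in[k]} x_i^{(t)}, & i=j,\\[2pt] \sum_{t\in [k]\setminus S_{ij}} x_i^{(t)}, & i<j,\\[2pt] \sum_{t\in[k]} x_i^{(t)}, & i>j,\end{cases}$$ where for $i<j$, $S_{ij}\subseteq[k]$ is the set of indices $t$ such that there is an edge from $i$ to $j$ colored $c_t$ (so $a_{ij}=\sum_{t\in[k]}x_i^{(t)}$ if there is no edge from $i$ to $j$, and $a_{ij}=0$ if there are edges from $i$ to $j$ of all $k$ colors). Then $$\det(A_{\Gamma_{k,R}})=1+\sum_{P}\ \sum_{a=1}^{k} x_{i_1}^{(r_1)}x_{i_2}^{(r_2)}\cdots x_{i_{t-1}}^{(r_{t-1})}\,x_{i_t}^{(a)},$$ where $P$ ranges over all colored paths $i_1\xrightarrow{c_{r_1}} i_2\xrightarrow{c_{r_2}}\cdots\xrightarrow{c_{r_{t-1}}} i_t$ in $\Gamma_{k,R}$ (with $t\ge 1$; a path consisting of a single vertex $i_1$ contributes $\sum_{a=1}^k x_{i_1}^{(a)}$).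
   Context: A $k$-colored digraph $\Gamma_{k,R}$ is a digraph equipped with a finite color set $R=\{c_1,\dots,c_k\}$ such that for each ordered pair of vertices $(i,j)$ there are $\ell$ directed edges from $i$ to $j$ for some $0\le \ell\le k$, these edges receiving pairwise distinct colors from $R$. It is acyclic if it has no directed cycle. A colored path $i_1\xrightarrow{c_{r_1}} i_2\xrightarrow{c_{r_2}}\cdots\xrightarrow{c_{r_{t-1}}} i_t$ is a directed path through the vertices $i_1,\dots,i_t$ in which, for each $s=1,\dots,t-1$, a specific edge from $i_s$ to $i_{s+1}$ of color $c_{r_s}$ is chosen (colors need not be distinct along the path); paths using different colored edges between the same vertices are counted as different paths. The variable $x_i^{(t)}$ is associated with vertex $i$ and color $c_t$. -}

module Defs where

open import Algebra.Bundles using (CommutativeRing)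
open import Data.Bool using (Bool; true; false; if_then_else_)
open import Data.Nat using (ℕ; zero; suc)
open import Data.Fin using (Fin; zero; suc; toℕ; punchIn)
open import Data.Fin.Properties using (_≟_; _<?_)
open import Relation.Nullary using (yes; no)
open import Function using (_∘_)

-- A k-colored digraph on vertex set Fin n (= [n]) with colour set Fin k:
-- E i j t ≡ true  iff there is an edge from i to j of colour c_t.
-- (Between an ordered pair there are ℓ ≤ k edges with pairwise distinct
-- colours, namely the colours t with E i j t ≡ true.)
ColDigraph : ℕ → ℕ → Set
ColDigraph n k = Fin n → Fin n → Fin k → Bool

module _ {c ℓ} (R : CommutativeRing c ℓ) where
  open CommutativeRing R using (Carrier; _+_; _*_; -_; 0#; 1#)

  ∑ : ∀ {m} → (Fin m → Carrier) → Carrier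
  ∑ {zero}  f = 0#
  ∑ {suc m} f = f zero + ∑ (f ∘ suc)

  alt : ℕ → Carrier
  alt zero    = 1#
  alt (suc m) = - alt m

  det : ∀ {m} → (Fin m → Fin m → Carrier) → Carrier
  det {zero}  M = 1#
  det {suc m} M =
    ∑ λ j → alt (toℕ j) * (M zero j * det (λ a b → M (suc a) (punchIn j b)))

  A : ∀ {n k} → ColDigraph n k → (Fin n → Fin k → Carrier) → Fin n → Fin n → Carrier
  A E x i j with i ≟ j | i <? j
  ... | yes _ | _     = 1# + ∑ (x i)
  ... | no _  | yes _ = ∑ λ t → if E i j t then 0# else x i t
  ... | no _  | no _  = ∑ (x i)

  -- sum, over all coloured paths i = i_1 -c_{r_1}-> i_2 -> ... -> i_t with
  -- exactly L edges starting at i, of  x_{i_1}^{(r_1)} ... x_{i_{t-1}}^{(r_{t-1})} * Σ_a x_{i_t}^{(a)}.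
  -- (Sum over all sequences of colours/vertices, each weighted by the
  -- indicator that the chosen coloured edges exist.)
  pathsFrom : ∀ {n k} → ColDigraph n k → (Fin n → Fin k → Carrier) → ℕ → Fin n → Carrier
  pathsFrom E x zero    i = ∑ (x i)
  pathsFrom E x (suc L) i =
    ∑ λ r → ∑ λ j → if E i j r then x i r * pathsFrom E x L j else 0#

  -- Since edges go from
  -- smaller to larger vertices, every path has at most n vertices, i.e.
  -- L < n edges, so summing over L < n covers all paths.
  pathTotal : ∀ {n k} → ColDigraph n k → (Fin n → Fin k → Carrier) → Carrier
  pathTotal {n} E x = 1# + ∑ {n} λ L → ∑ λ i → pathsFrom E x (toℕ L) i

-- Put s i = Σ_t x_i^(t) and let Y i j be the sum of x_i^(t) over the colours t of the edges i → j. The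
-- labelling makes Y strictly upper triangular, and A = I − Y + s 𝟙ᵀ. The vector Q, with Q i the sum over the
-- coloured paths starting at i, satisfies Q = s + Y Q (a path is a single vertex or an edge followed by a
-- path), so the theorem is the matrix determinant lemma det (I − Y + s 𝟙ᵀ) = 1 + 𝟙ᵀ Q.
--
-- That lemma is proved by induction, expanding along the first row. The (0,0) cofactor is given by the
-- induction hypothesis. Any other row paired with the cofactor vector is a determinant with two equal rows,
-- hence zero, so the remaining cofactors c satisfy c + φ s′ = Y′ c with φ the sum of all cofactors (primes
-- drop the first index); as Y′ is nilpotent, c = − φ Q′. Finally φ = 1: it is the determinant with first
-- row 𝟙, and subtracting multiples of that row from the others removes s, reducing to the case s = 0.
module Submission where

open import Defs
open import Algebra.Bundles using (CommutativeRing)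
open import Data.Bool using (true; false; if_then_else_)
open import Data.Empty using (⊥-elim)
open import Data.Fin as Fin using (Fin; zero; suc; toℕ; punchIn; inject₁; fromℕ; _<_)
open import Data.Fin.Properties using (suc-injective; _≟_; _<?_)
import Data.Fin.Properties as Finₚ
open import Data.Nat as ℕ using (ℕ; zero; suc; _≤_; z≤n; s≤s)
import Data.Nat.Properties as ℕₚ
open import Data.Vec.Functional using (_∷_; removeAt)
open import Function using (_∘_)
open import Level using (_⊔_)
open import Relation.Binary.PropositionalEquality as ≡ using (_≡_; _≢_)
open import Relation.Nullary using (yes; no)

punchIn-punchIn-swap : ∀ {m} (j : Fin (suc (suc m))) k j′ k′ →
                       punchIn j k ≡ j′ → punchIn j′ k′ ≡ j →
                       ∀ b → punchIn j (punchIn k b) ≡ punchIn j′ (punchIn k′ b)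
punchIn-punchIn-swap zero    k       _ zero     ≡.refl ≡.refl b       = ≡.refl
punchIn-punchIn-swap (suc j) zero    _ k′       ≡.refl ≡.refl b       = ≡.refl
punchIn-punchIn-swap (suc j) (suc k) _ (suc k′) ≡.refl e      zero    = ≡.refl
punchIn-punchIn-swap (suc j) (suc k) _ (suc k′) ≡.refl e      (suc b) =
  ≡.cong suc (punchIn-punchIn-swap j k _ k′ ≡.refl (suc-injective e) b)

module _ {c ℓ} (R : CommutativeRing c ℓ) where
  open CommutativeRing R hiding (zero)
  open import Algebra.Properties.Ring ring
    using (-‿distribˡ-*; -‿distribʳ-*; -‿+-comm; -‿involutive; -0#≈0#; -1*x≈-x;
           +-inverseˡ-unique; x∙y⁻¹≈ε⇒x≈y)
  open import Algebra.Properties.Semiring.Sum semiring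
    using (sum; sum-cong-≋; sum-cong-≗; sum-replicate-zero; sum-init-last;
           ∑-distrib-+; ∑-comm; *-distribˡ-sum; *-distribʳ-sum)
  open import Algebra.Solver.Ring.NaturalCoefficients.Default commutativeSemiring
  open import Relation.Binary.Reasoning.Setoid setoid

  Row : ℕ → Set c
  Row m = Fin m → Carrier

  Mat : ℕ → Set c
  Mat m = Fin m → Row m

  ∑≡sum : ∀ {m} (f : Row m) → ∑ R f ≡ sum f
  ∑≡sum {zero}  f = ≡.refl
  ∑≡sum {suc m} f = ≡.cong (f zero +_) (∑≡sum (f ∘ suc))

  ∑-cong : ∀ {m} {f g : Row m} → (∀ i → f i ≈ g i) → ∑ R f ≈ ∑ R g
  ∑-cong {f = f} {g} f≈g rewrite ∑≡sum f | ∑≡sum g = sum-cong-≋ f≈g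

  ∑-zero : ∀ {m} {f : Row m} → (∀ i → f i ≈ 0#) → ∑ R f ≈ 0#
  ∑-zero {m} {f} f≈0 = begin
    ∑ R f               ≈⟨ ∑-cong f≈0 ⟩
    ∑ R {m} (λ _ → 0#)  ≡⟨ ∑≡sum {m} (λ _ → 0#) ⟩
    sum {m} (λ _ → 0#)  ≈⟨ sum-replicate-zero m ⟩
    0#                  ∎

  ∑-+ : ∀ {m} (f g : Row m) → ∑ R (λ i → f i + g i) ≈ ∑ R f + ∑ R g
  ∑-+ f g rewrite ∑≡sum f | ∑≡sum g | ∑≡sum (λ i → f i + g i) = ∑-distrib-+ f g

  *-distribˡ-∑ : ∀ {m} (k : Carrier) (f : Row m) → k * ∑ R f ≈ ∑ R (λ i → k * f i)
  *-distribˡ-∑ k f rewrite ∑≡sum f | ∑≡sum (λ i → k * f i) = *-distribˡ-sum k f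

  *-distribʳ-∑ : ∀ {m} (k : Carrier) (f : Row m) → ∑ R f * k ≈ ∑ R (λ i → f i * k)
  *-distribʳ-∑ k f rewrite ∑≡sum f | ∑≡sum (λ i → f i * k) = *-distribʳ-sum k f

  ∑-neg : ∀ {m} (f : Row m) → ∑ R (λ i → - f i) ≈ - ∑ R f
  ∑-neg f = begin
    ∑ R (λ i → - f i)       ≈⟨ ∑-cong (λ i → sym (-1*x≈-x (f i))) ⟩
    ∑ R (λ i → - 1# * f i)  ≈⟨ *-distribˡ-∑ (- 1#) f ⟨
    - 1# * ∑ R f            ≈⟨ -1*x≈-x _ ⟩
    - ∑ R f                 ∎

  ∑-swap : ∀ {m n} (f : Fin m → Fin n → Carrier) →
           ∑ R (λ i → ∑ R (f i)) ≈ ∑ R (λ j → ∑ R (λ i → f i j))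
  ∑-swap f = begin
    ∑ R (λ i → ∑ R (f i))          ≡⟨ ∑≡sum (λ i → ∑ R (f i)) ⟩
    sum (λ i → ∑ R (f i))          ≡⟨ sum-cong-≗ (λ i → ∑≡sum (f i)) ⟩
    sum (λ i → sum (f i))          ≈⟨ ∑-comm f ⟩
    sum (λ j → sum (λ i → f i j))  ≡⟨ sum-cong-≗ (λ j → ∑≡sum (λ i → f i j)) ⟨
    sum (λ j → ∑ R (λ i → f i j))  ≡⟨ ∑≡sum (λ j → ∑ R (λ i → f i j)) ⟨
    ∑ R (λ j → ∑ R (λ i → f i j))  ∎

  ∑-init-last : ∀ {m} (f : Row (suc m)) → ∑ R f ≈ ∑ R (f ∘ inject₁) + f (fromℕ m)
  ∑-init-last f rewrite ∑≡sum f | ∑≡sum (f ∘ inject₁) = sum-init-last f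

  ∑-tail : ∀ {m} (f : Row (suc m)) → f zero ≈ 0# → ∑ R f ≈ ∑ R (f ∘ suc)
  ∑-tail f f₀≈0 = trans (+-congʳ f₀≈0) (+-identityˡ _)

  det-cong : ∀ {m} {M M′ : Mat m} → (∀ a b → M a b ≈ M′ a b) → det R M ≈ det R M′
  det-cong {zero}  M≈M′ = refl
  det-cong {suc m} M≈M′ = ∑-cong λ j →
    *-congˡ {alt R (toℕ j)} (*-cong (M≈M′ zero j) (det-cong λ a b → M≈M′ (suc a) (punchIn j b)))

  cofactor : ∀ {m} → (Fin m → Row (suc m)) → Row (suc m)
  cofactor N j = alt R (toℕ j) * det R (λ a → removeAt (N a) j)

  det-expand : ∀ {m} (M : Mat (suc m)) → det R M ≈ ∑ R (λ j → M zero j * cofactor (M ∘ suc) j)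
  det-expand M = ∑-cong λ j →
    solve 3 (λ a x d → a :* (x :* d) := x :* (a :* d)) refl
      (alt R (toℕ j)) (M zero j) (det R (λ a → removeAt (M (suc a)) j))

  det-+₀ : ∀ {m} (u v : Row (suc m)) (N : Fin m → Row (suc m)) →
           det R ((λ j → u j + v j) ∷ N) ≈ det R (u ∷ N) + det R (v ∷ N)
  det-+₀ u v N = begin
    det R ((λ j → u j + v j) ∷ N)                         ≈⟨ det-expand ((λ j → u j + v j) ∷ N) ⟩
    ∑ R (λ j → (u j + v j) * cofactor N j)
      ≈⟨ ∑-cong (λ j → distribʳ (cofactor N j) (u j) (v j)) ⟩
    ∑ R (λ j → u j * cofactor N j + v j * cofactor N j)
      ≈⟨ ∑-+ (λ j → u j * cofactor N j) (λ j → v j * cofactor N j) ⟩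
    ∑ R (λ j → u j * cofactor N j) + ∑ R (λ j → v j * cofactor N j)
      ≈⟨ +-cong (det-expand (u ∷ N)) (det-expand (v ∷ N)) ⟨
    det R (u ∷ N) + det R (v ∷ N)                         ∎

  det-*₀ : ∀ {m} (t : Carrier) (u : Row (suc m)) (N : Fin m → Row (suc m)) →
           det R ((λ j → t * u j) ∷ N) ≈ t * det R (u ∷ N)
  det-*₀ t u N = begin
    det R ((λ j → t * u j) ∷ N)           ≈⟨ det-expand ((λ j → t * u j) ∷ N) ⟩
    ∑ R (λ j → (t * u j) * cofactor N j)  ≈⟨ ∑-cong (λ j → *-assoc t (u j) (cofactor N j)) ⟩
    ∑ R (λ j → t * (u j * cofactor N j))  ≈⟨ *-distribˡ-∑ t (λ j → u j * cofactor N j) ⟨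
    t * ∑ R (λ j → u j * cofactor N j)    ≈⟨ *-congˡ (det-expand (u ∷ N)) ⟨
    t * det R (u ∷ N)                     ∎

  det-∷-η : ∀ {m} (r : Row (suc (suc m))) (N : Fin (suc m) → Row (suc (suc m))) →
            det R (r ∷ N) ≈ det R (r ∷ N zero ∷ (N ∘ suc))
  det-∷-η r N = det-cong {M = r ∷ N} {M′ = r ∷ N zero ∷ (N ∘ suc)}
    λ { zero b → refl ; (suc zero) b → refl ; (suc (suc a)) b → refl }

  det-minor-∷ : ∀ {m} (y : Row (suc (suc m))) (N : Fin m → Row (suc (suc m))) j →
                det R (λ a → removeAt ((y ∷ N) a) j) ≈ det R (removeAt y j ∷ λ a → removeAt (N a) j)
  det-minor-∷ y N j = det-cong {M = λ a → removeAt ((y ∷ N) a) j} {M′ = removeAt y j ∷ λ a → removeAt (N a) j}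
    λ { zero b → refl ; (suc a) b → refl }

  det-cong-minors : ∀ {m} (x : Row (suc m)) (N₁ N₂ : Fin m → Row (suc m)) →
                    (∀ j → det R (λ a → removeAt (N₁ a) j) ≈ det R (λ a → removeAt (N₂ a) j)) →
                    det R (x ∷ N₁) ≈ det R (x ∷ N₂)
  det-cong-minors x N₁ N₂ minors≈ = ∑-cong λ j → *-congˡ {alt R (toℕ j)} (*-congˡ {x j} (minors≈ j))

  det-+₁ : ∀ {m} (r u v : Row (suc (suc m))) (N : Fin m → Row (suc (suc m))) →
           det R (r ∷ (λ j → u j + v j) ∷ N) ≈ det R (r ∷ u ∷ N) + det R (r ∷ v ∷ N)
  det-+₁ {m} r u v N = begin
    det R (r ∷ (λ j → u j + v j) ∷ N)                          ≈⟨ det-expand (r ∷ (λ j → u j + v j) ∷ N) ⟩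
    ∑ R (λ j → r j * cofactor ((λ j → u j + v j) ∷ N) j)
      ≈⟨ ∑-cong (λ j → *-congˡ {r j} (cofactor-+ j)) ⟩
    ∑ R (λ j → r j * (cofactor (u ∷ N) j + cofactor (v ∷ N) j))
      ≈⟨ ∑-cong (λ j → distribˡ (r j) (cofactor (u ∷ N) j) (cofactor (v ∷ N) j)) ⟩
    ∑ R (λ j → r j * cofactor (u ∷ N) j + r j * cofactor (v ∷ N) j)
      ≈⟨ ∑-+ (λ j → r j * cofactor (u ∷ N) j) (λ j → r j * cofactor (v ∷ N) j) ⟩
    ∑ R (λ j → r j * cofactor (u ∷ N) j) + ∑ R (λ j → r j * cofactor (v ∷ N) j)
      ≈⟨ +-cong (det-expand (r ∷ u ∷ N)) (det-expand (r ∷ v ∷ N)) ⟨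
    det R (r ∷ u ∷ N) + det R (r ∷ v ∷ N)                      ∎
    where
    N′ : Fin (suc (suc m)) → Fin m → Row (suc m)
    N′ j a = removeAt (N a) j
    cofactor-+ : ∀ j → cofactor ((λ j → u j + v j) ∷ N) j ≈ cofactor (u ∷ N) j + cofactor (v ∷ N) j
    cofactor-+ j = begin
      a * det R (λ a → removeAt (((λ j → u j + v j) ∷ N) a) j)
        ≈⟨ *-congˡ {a} (det-minor-∷ (λ j → u j + v j) N j) ⟩
      a * det R ((λ b → u (punchIn j b) + v (punchIn j b)) ∷ N′ j)
        ≈⟨ *-congˡ {a} (det-+₀ (removeAt u j) (removeAt v j) (N′ j)) ⟩
      a * (det R (removeAt u j ∷ N′ j) + det R (removeAt v j ∷ N′ j))
        ≈⟨ distribˡ a (det R (removeAt u j ∷ N′ j)) (det R (removeAt v j ∷ N′ j)) ⟩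
      a * det R (removeAt u j ∷ N′ j) + a * det R (removeAt v j ∷ N′ j)
        ≈⟨ +-cong (*-congˡ {a} (det-minor-∷ u N j)) (*-congˡ {a} (det-minor-∷ v N j)) ⟨
      cofactor (u ∷ N) j + cofactor (v ∷ N) j  ∎
      where
      a : Carrier
      a = alt R (toℕ j)

  -- Alternation

  -- g j k depends only on the set {j, punchIn j k} of columns it omits.
  PairSymmetric : ∀ {m} → (Fin (suc m) → Fin m → Carrier) → Set ℓ
  PairSymmetric g = ∀ j k j′ k′ → punchIn j k ≡ j′ → punchIn j′ k′ ≡ j → g j k ≈ g j′ k′

  -x[y[z-w]]≈-x[yz]+x[yw] : ∀ x y z w → (- x) * (y * (z + - w)) ≈ - (x * (y * z)) + x * (y * w)
  -x[y[z-w]]≈-x[yz]+x[yw] x y z w = begin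
    (- x) * (y * (z + - w))              ≈⟨ -‿distribˡ-* x _ ⟨
    - (x * (y * (z + - w)))              ≈⟨ -‿cong (trans (*-congˡ (distribˡ y z (- w))) (distribˡ x _ _)) ⟩
    - (x * (y * z) + x * (y * - w))
      ≈⟨ -‿cong (+-congˡ (trans (*-congˡ (sym (-‿distribʳ-* y w))) (sym (-‿distribʳ-* x _)))) ⟩
    - (x * (y * z) + - (x * (y * w)))    ≈⟨ -‿+-comm _ _ ⟨
    - (x * (y * z)) + - - (x * (y * w))  ≈⟨ +-congˡ (-‿involutive _) ⟩
    - (x * (y * z)) + x * (y * w)        ∎

  -- The determinant of a matrix whose first two rows both equal r, expanded along both rows; g j k is the
  -- complementary minor. The terms removing the columns {j, j′} in the two possible orders cancel.
  double-expansion-vanishes : ∀ m (r : Row (suc m)) (g : Fin (suc m) → Fin m → Carrier) → PairSymmetric g →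
    ∑ R (λ j → alt R (toℕ j) * (r j * ∑ R (λ k → alt R (toℕ k) * (r (punchIn j k) * g j k)))) ≈ 0#
  double-expansion-vanishes zero    r g _     = trans (+-identityʳ _) (trans (*-congˡ (zeroʳ (r zero))) (zeroʳ _))
  double-expansion-vanishes (suc m) r g g-sym = begin
    column₀ + ∑ R otherColumn
      ≈⟨ +-cong column₀≈∑cross (∑-cong otherColumn≈-cross+rest) ⟩
    ∑ R cross + ∑ R (λ j → - cross j + rest j)      ≈⟨ +-congˡ (∑-+ (λ j → - cross j) rest) ⟩
    ∑ R cross + (∑ R (λ j → - cross j) + ∑ R rest)  ≈⟨ +-congˡ (+-cong (∑-neg cross) ∑rest≈0) ⟩
    ∑ R cross + (- ∑ R cross + 0#)                  ≈⟨ +-congˡ (+-identityʳ _) ⟩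
    ∑ R cross + - ∑ R cross                         ≈⟨ -‿inverseʳ _ ⟩
    0#                                              ∎
    where
    column₀ : Carrier
    column₀ = 1# * (r zero * ∑ R (λ k → alt R (toℕ k) * (r (suc k) * g zero k)))
    inner : Fin (suc m) → Fin m → Carrier
    inner j k = r (suc (punchIn j k)) * g (suc j) (suc k)
    otherColumn cross rest : Row (suc m)
    otherColumn j = - alt R (toℕ j) * (r (suc j) * (1# * (r zero * g (suc j) zero)
                                                    + ∑ R (λ k → - alt R (toℕ k) * inner j k)))
    cross k = alt R (toℕ k) * (r zero * (r (suc k) * g (suc k) zero))
    rest j = alt R (toℕ j) * (r (suc j) * ∑ R (λ k → alt R (toℕ k) * inner j k))
    ∑rest≈0 : ∑ R rest ≈ 0#
    ∑rest≈0 = double-expansion-vanishes m (r ∘ suc) (λ j k → g (suc j) (suc k))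
      λ j k j′ k′ e e′ → g-sym (suc j) (suc k) (suc j′) (suc k′) (≡.cong suc e) (≡.cong suc e′)
    column₀≈∑cross : column₀ ≈ ∑ R cross
    column₀≈∑cross = begin
      column₀                                                       ≈⟨ *-identityˡ _ ⟩
      r zero * ∑ R (λ k → alt R (toℕ k) * (r (suc k) * g zero k))
        ≈⟨ *-distribˡ-∑ (r zero) (λ k → alt R (toℕ k) * (r (suc k) * g zero k)) ⟩
      ∑ R (λ k → r zero * (alt R (toℕ k) * (r (suc k) * g zero k)))
        ≈⟨ ∑-cong (λ k → trans (*-congˡ (*-congˡ (*-congˡ (g-sym zero k (suc k) zero ≡.refl ≡.refl))))
              (solve 4 (λ z a x y → z :* (a :* (x :* y)) := a :* (z :* (x :* y))) refl
                 (r zero) (alt R (toℕ k)) (r (suc k)) (g (suc k) zero))) ⟩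
      ∑ R cross                                                     ∎
    otherColumn≈-cross+rest : ∀ j → otherColumn j ≈ - cross j + rest j
    otherColumn≈-cross+rest j = begin
      otherColumn j
        ≈⟨ *-congˡ (*-congˡ (+-congˡ (trans (∑-cong (λ k → sym (-‿distribˡ-* _ (inner j k))))
                                             (∑-neg (λ k → alt R (toℕ k) * inner j k))))) ⟩
      - a * (r (suc j) * (1# * (r zero * g (suc j) zero) + - S))
        ≈⟨ -x[y[z-w]]≈-x[yz]+x[yw] a (r (suc j)) _ S ⟩
      - (a * (r (suc j) * (1# * (r zero * g (suc j) zero)))) + a * (r (suc j) * S)
        ≈⟨ +-congʳ (-‿cong (solve 4 (λ a u z y → a :* (u :* (con 1 :* (z :* y))) := a :* (z :* (u :* y))) refl
              a (r (suc j)) (r zero) (g (suc j) zero))) ⟩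
      - cross j + rest j                                            ∎
      where
      a S : Carrier
      a = alt R (toℕ j)
      S = ∑ R (λ k → alt R (toℕ k) * inner j k)

  det-rows₀₁-equal : ∀ {m} (r : Row (suc (suc m))) (N : Fin m → Row (suc (suc m))) → det R (r ∷ r ∷ N) ≈ 0#
  det-rows₀₁-equal {m} r N =
    double-expansion-vanishes (suc m) r (λ j k → det R (λ a b → N a (punchIn j (punchIn k b))))
      λ j k j′ k′ e e′ → det-cong λ a b →
        reflexive (≡.cong (N a) (punchIn-punchIn-swap j k j′ k′ e e′ b))

  det-swap₀₁ : ∀ {m} (u v : Row (suc (suc m))) (N : Fin m → Row (suc (suc m))) →
               det R (u ∷ v ∷ N) ≈ - det R (v ∷ u ∷ N)
  det-swap₀₁ {m} u v N = +-inverseˡ-unique _ _ (begin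
    det R (u ∷ v ∷ N) + det R (v ∷ u ∷ N)
      ≈⟨ +-cong (+-identityˡ _) (+-identityʳ _) ⟨
    (0# + det R (u ∷ v ∷ N)) + (det R (v ∷ u ∷ N) + 0#)
      ≈⟨ +-cong (+-congʳ (det-rows₀₁-equal u N)) (+-congˡ (det-rows₀₁-equal v N)) ⟨
    (det R (u ∷ u ∷ N) + det R (u ∷ v ∷ N)) + (det R (v ∷ u ∷ N) + det R (v ∷ v ∷ N))
      ≈⟨ +-cong (det-+₁ u u v N) (det-+₁ v u v N) ⟨
    det R (u ∷ w ∷ N) + det R (v ∷ w ∷ N)  ≈⟨ det-+₀ u v (w ∷ N) ⟨
    det R (w ∷ w ∷ N)                      ≈⟨ det-rows₀₁-equal w N ⟩
    0#                                     ∎)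
    where
    w : Row (suc (suc m))
    w j = u j + v j

  det-row₁-add-row₀ : ∀ {m} (t : Carrier) (r u : Row (suc (suc m))) (N : Fin m → Row (suc (suc m))) →
                      det R (r ∷ (λ j → u j + t * r j) ∷ N) ≈ det R (r ∷ u ∷ N)
  det-row₁-add-row₀ t r u N = begin
    det R (r ∷ (λ j → u j + t * r j) ∷ N)    ≈⟨ det-swap₀₁ r (λ j → u j + t * r j) N ⟩
    - det R ((λ j → u j + t * r j) ∷ r ∷ N)  ≈⟨ -‿cong (det-+₀ u (λ j → t * r j) (r ∷ N)) ⟩
    - (det R (u ∷ r ∷ N) + det R ((λ j → t * r j) ∷ r ∷ N))
      ≈⟨ -‿cong (+-congˡ (trans (det-*₀ t r (r ∷ N))
                                 (trans (*-congˡ (det-rows₀₁-equal r N)) (zeroʳ t)))) ⟩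
    - (det R (u ∷ r ∷ N) + 0#)               ≈⟨ -‿cong (+-identityʳ _) ⟩
    - det R (u ∷ r ∷ N)                      ≈⟨ -‿cong (det-swap₀₁ u r N) ⟩
    - - det R (r ∷ u ∷ N)                    ≈⟨ -‿involutive _ ⟩
    det R (r ∷ u ∷ N)                        ∎

  det-row₀-equals-row : ∀ {m} (r : Row (suc m)) (N : Fin m → Row (suc m)) (b : Fin m) →
                        (∀ j → N b j ≈ r j) → det R (r ∷ N) ≈ 0#
  det-row₀-equals-row r N zero    N₀≈r = begin
    det R (r ∷ N)              ≈⟨ det-cong {M = r ∷ N} {M′ = r ∷ r ∷ (N ∘ suc)}
                                    (λ { zero j → refl ; (suc zero) j → N₀≈r j ; (suc (suc a)) j → refl }) ⟩
    det R (r ∷ r ∷ (N ∘ suc))  ≈⟨ det-rows₀₁-equal r (N ∘ suc) ⟩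
    0#                         ∎
  det-row₀-equals-row r N (suc b) N[b]≈r = begin
    det R (r ∷ N)                     ≈⟨ det-∷-η r N ⟩
    det R (r ∷ N zero ∷ (N ∘ suc))    ≈⟨ det-swap₀₁ r (N zero) (N ∘ suc) ⟩
    - det R (N zero ∷ r ∷ (N ∘ suc))
      ≈⟨ -‿cong (trans (det-expand (N zero ∷ r ∷ (N ∘ suc))) (∑-zero cofactor-term≈0)) ⟩
    - 0#                              ≈⟨ -0#≈0# ⟩
    0#                                ∎
    where
    cofactor-term≈0 : ∀ j → N zero j * cofactor (r ∷ (N ∘ suc)) j ≈ 0#
    cofactor-term≈0 j = begin
      N zero j * (alt R (toℕ j) * det R (λ a → removeAt ((r ∷ (N ∘ suc)) a) j))
        ≈⟨ *-congˡ {N zero j} (*-congˡ {alt R (toℕ j)} (det-minor-∷ r (N ∘ suc) j)) ⟩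
      N zero j * (alt R (toℕ j) * det R (removeAt r j ∷ λ a → removeAt (N (suc a)) j))
        ≈⟨ *-congˡ {N zero j} (*-congˡ {alt R (toℕ j)}
             (det-row₀-equals-row (removeAt r j) (λ a → removeAt (N (suc a)) j) b (N[b]≈r ∘ punchIn j))) ⟩
      N zero j * (alt R (toℕ j) * 0#)  ≈⟨ trans (*-congˡ {N zero j} (zeroʳ _)) (zeroʳ _) ⟩
      0#                               ∎

  -- Clear row 1 directly, then swap it to the top: the rows still to be cleared become those of each minor.
  det-add-multiples-of-row₀ : ∀ {m} (r : Row (suc m)) (N : Fin m → Row (suc m)) (t : Row m) →
                              det R (r ∷ λ a j → N a j + t a * r j) ≈ det R (r ∷ N)
  det-add-multiples-of-row₀ {zero}  r N t = refl
  det-add-multiples-of-row₀ {suc m} r N t = begin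
    det R (r ∷ N′)                     ≈⟨ det-∷-η r N′ ⟩
    det R (r ∷ N′ zero ∷ (N′ ∘ suc))   ≈⟨ det-row₁-add-row₀ (t zero) r (N zero) (N′ ∘ suc) ⟩
    det R (r ∷ N zero ∷ (N′ ∘ suc))    ≈⟨ det-swap₀₁ r (N zero) (N′ ∘ suc) ⟩
    - det R (N zero ∷ r ∷ (N′ ∘ suc))
      ≈⟨ -‿cong (det-cong-minors (N zero) (r ∷ (N′ ∘ suc)) (r ∷ (N ∘ suc)) minors≈) ⟩
    - det R (N zero ∷ r ∷ (N ∘ suc))   ≈⟨ -‿cong (det-swap₀₁ (N zero) r (N ∘ suc)) ⟩
    - - det R (r ∷ N zero ∷ (N ∘ suc)) ≈⟨ -‿involutive _ ⟩
    det R (r ∷ N zero ∷ (N ∘ suc))     ≈⟨ det-∷-η r N ⟨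
    det R (r ∷ N)                      ∎
    where
    N′ : Fin (suc m) → Row (suc (suc m))
    N′ a j = N a j + t a * r j
    minors≈ : ∀ j → det R (λ a → removeAt ((r ∷ (N′ ∘ suc)) a) j)
                  ≈ det R (λ a → removeAt ((r ∷ (N ∘ suc)) a) j)
    minors≈ j = begin
      det R (λ a → removeAt ((r ∷ (N′ ∘ suc)) a) j)          ≈⟨ det-minor-∷ r (N′ ∘ suc) j ⟩
      det R (removeAt r j ∷ λ a → removeAt (N′ (suc a)) j)
        ≈⟨ det-add-multiples-of-row₀ (removeAt r j) (λ a → removeAt (N (suc a)) j) (t ∘ suc) ⟩
      det R (removeAt r j ∷ λ a → removeAt (N (suc a)) j)   ≈⟨ det-minor-∷ r (N ∘ suc) j ⟨
      det R (λ a → removeAt ((r ∷ (N ∘ suc)) a) j)           ∎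

  -- The determinant of I − Y + s 𝟙ᵀ for strictly upper triangular Y

  δ : ∀ {m} → Fin m → Fin m → Carrier
  δ zero    zero    = 1#
  δ zero    (suc _) = 0#
  δ (suc _) zero    = 0#
  δ (suc a) (suc b) = δ a b

  δ-diagonal : ∀ {m} (i : Fin m) → δ i i ≡ 1#
  δ-diagonal zero    = ≡.refl
  δ-diagonal (suc i) = δ-diagonal i

  δ-offDiagonal : ∀ {m} {i j : Fin m} → i ≢ j → δ i j ≡ 0#
  δ-offDiagonal {i = zero}  {zero}  i≢j = ⊥-elim (i≢j ≡.refl)
  δ-offDiagonal {i = zero}  {suc j} i≢j = ≡.refl
  δ-offDiagonal {i = suc i} {zero}  i≢j = ≡.refl
  δ-offDiagonal {i = suc i} {suc j} i≢j = δ-offDiagonal (i≢j ∘ ≡.cong suc)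

  ∑-δ : ∀ {m} (i : Fin m) (f : Row m) → ∑ R (λ j → δ i j * f j) ≈ f i
  ∑-δ zero    f = trans (+-cong (*-identityˡ (f zero)) (∑-zero λ j → zeroˡ (f (suc j)))) (+-identityʳ _)
  ∑-δ (suc i) f = trans (+-cong (zeroˡ (f zero)) (∑-δ i (f ∘ suc))) (+-identityˡ _)

  I-Y+s1ᵀ : ∀ {m} → Row m → Mat m → Mat m
  I-Y+s1ᵀ s Y a b = (δ a b + s a) + - Y a b

  I-Y+s1ᵀ-apply : ∀ {m} (s : Row m) (Y : Mat m) (i : Fin m) (v : Row m) →
                  ∑ R (λ j → I-Y+s1ᵀ s Y i j * v j) ≈ (v i + s i * ∑ R v) + - ∑ R (λ j → Y i j * v j)
  I-Y+s1ᵀ-apply s Y i v = begin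
    ∑ R (λ j → ((δ i j + s i) + - Y i j) * v j)
      ≈⟨ ∑-cong (λ j → trans (distribʳ (v j) _ _) (+-cong (distribʳ (v j) _ _) (sym (-‿distribˡ-* _ _)))) ⟩
    ∑ R (λ j → (δ i j * v j + s i * v j) + - (Y i j * v j))
      ≈⟨ ∑-+ (λ j → δ i j * v j + s i * v j) (λ j → - (Y i j * v j)) ⟩
    ∑ R (λ j → δ i j * v j + s i * v j) + ∑ R (λ j → - (Y i j * v j))
      ≈⟨ +-cong (∑-+ (λ j → δ i j * v j) (λ j → s i * v j)) (∑-neg (λ j → Y i j * v j)) ⟩
    (∑ R (λ j → δ i j * v j) + ∑ R (λ j → s i * v j)) + - ∑ R (λ j → Y i j * v j)
      ≈⟨ +-congʳ (+-cong (∑-δ i v) (sym (*-distribˡ-∑ (s i) v))) ⟩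
    (v i + s i * ∑ R v) + - ∑ R (λ j → Y i j * v j)  ∎

  minor₀₀ : ∀ {m} → Mat (suc m) → Mat m
  minor₀₀ Y a b = Y (suc a) (suc b)

  StrictlyUpper : ∀ {m} → Mat m → Set ℓ
  StrictlyUpper Y = ∀ a b → b Fin.≤ a → Y a b ≈ 0#

  minor₀₀-strictlyUpper : ∀ {m} {Y : Mat (suc m)} → StrictlyUpper Y → StrictlyUpper (minor₀₀ Y)
  minor₀₀-strictlyUpper Y-upper a b b≤a = Y-upper (suc a) (suc b) (s≤s b≤a)

  strictlyUpper-∑-tail : ∀ {m} {Y : Mat (suc m)} → StrictlyUpper Y → ∀ a (f : Row (suc m)) →
                         ∑ R (λ j → Y a j * f j) ≈ ∑ R (λ j → Y a (suc j) * f (suc j))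
  strictlyUpper-∑-tail {Y = Y} Y-upper a f =
    ∑-tail (λ j → Y a j * f j) (trans (*-congʳ (Y-upper a zero z≤n)) (zeroˡ (f zero)))

  strictlyUpper-fixedPoint≈0 : ∀ {m} (Y : Mat m) → StrictlyUpper Y → (d : Row m) →
                               (∀ i → d i ≈ ∑ R (λ j → Y i j * d j)) → ∀ i → d i ≈ 0#
  strictlyUpper-fixedPoint≈0 {suc m} Y Y-upper d d≈Yd = d≈0
    where
    d′≈0 : ∀ i → d (suc i) ≈ 0#
    d′≈0 = strictlyUpper-fixedPoint≈0 (minor₀₀ Y) (minor₀₀-strictlyUpper Y-upper) (d ∘ suc)
             λ i → trans (d≈Yd (suc i)) (strictlyUpper-∑-tail Y-upper (suc i) d)
    d≈0 : ∀ i → d i ≈ 0#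
    d≈0 zero    = trans (d≈Yd zero) (trans (strictlyUpper-∑-tail Y-upper zero d)
                    (∑-zero λ j → trans (*-congˡ (d′≈0 j)) (zeroʳ _)))
    d≈0 (suc i) = d′≈0 i

  Solves-I-Y : ∀ {m} → Mat m → Row m → Row m → Set ℓ
  Solves-I-Y Y s Q = ∀ i → Q i ≈ s i + ∑ R (λ j → Y i j * Q j)

  Solves-I-Y-minor₀₀ : ∀ {m} {Y : Mat (suc m)} {s Q : Row (suc m)} → StrictlyUpper Y →
                       Solves-I-Y Y s Q → Solves-I-Y (minor₀₀ Y) (s ∘ suc) (Q ∘ suc)
  Solves-I-Y-minor₀₀ {Q = Q} Y-upper Q-sol i =
    trans (Q-sol (suc i)) (+-congˡ (strictlyUpper-∑-tail Y-upper (suc i) Q))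

  RankOneUpdateFormula : ℕ → Set (c ⊔ ℓ)
  RankOneUpdateFormula m = ∀ (s : Row m) (Y : Mat m) (Q : Row m) → StrictlyUpper Y → Solves-I-Y Y s Q →
                           det R (I-Y+s1ᵀ s Y) ≈ 1# + ∑ R Q

  module I-Y+s1ᵀ-Cofactors {m} (IH : RankOneUpdateFormula m) (Y : Mat (suc m)) (Y-upper : StrictlyUpper Y) where

    cofactors : Row (suc m) → Row (suc m)
    cofactors s = cofactor (I-Y+s1ᵀ s Y ∘ suc)

    cofactor₀ : ∀ s Q′ → Solves-I-Y (minor₀₀ Y) (s ∘ suc) Q′ → cofactors s zero ≈ 1# + ∑ R Q′
    cofactor₀ s Q′ Q′-sol =
      trans (*-identityˡ _) (IH (s ∘ suc) (minor₀₀ Y) Q′ (minor₀₀-strictlyUpper Y-upper) Q′-sol)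

    cofactor-suc : ∀ s Q′ → Solves-I-Y (minor₀₀ Y) (s ∘ suc) Q′ →
                   ∀ a → cofactors s (suc a) ≈ - (∑ R (cofactors s) * Q′ a)
    cofactor-suc s Q′ Q′-sol a =
      +-inverseˡ-unique _ _ (strictlyUpper-fixedPoint≈0 Y′ (minor₀₀-strictlyUpper Y-upper) d d≈Y′d a)
      where
      Y′ : Mat m
      Y′ = minor₀₀ Y
      cof : Row (suc m)
      cof = cofactors s
      φ : Carrier
      φ = ∑ R cof
      d : Row m
      d b = cof (suc b) + φ * Q′ b
      row-relation : ∀ b → cof (suc b) + s (suc b) * φ ≈ ∑ R (λ k → Y′ b k * cof (suc k))
      row-relation b = x∙y⁻¹≈ε⇒x≈y _ _ (begin
        (cof (suc b) + s (suc b) * φ) + - ∑ R (λ k → Y′ b k * cof (suc k))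
          ≈⟨ +-congˡ (-‿cong (strictlyUpper-∑-tail Y-upper (suc b) cof)) ⟨
        (cof (suc b) + s (suc b) * φ) + - ∑ R (λ j → Y (suc b) j * cof j)
          ≈⟨ I-Y+s1ᵀ-apply s Y (suc b) cof ⟨
        ∑ R (λ j → I-Y+s1ᵀ s Y (suc b) j * cof j)
          ≈⟨ det-expand (I-Y+s1ᵀ s Y (suc b) ∷ (I-Y+s1ᵀ s Y ∘ suc)) ⟨
        det R (I-Y+s1ᵀ s Y (suc b) ∷ (I-Y+s1ᵀ s Y ∘ suc))
          ≈⟨ det-row₀-equals-row (I-Y+s1ᵀ s Y (suc b)) (I-Y+s1ᵀ s Y ∘ suc) b (λ j → refl) ⟩
        0#  ∎)
      d≈Y′d : ∀ b → d b ≈ ∑ R (λ k → Y′ b k * d k)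
      d≈Y′d b = begin
        cof (suc b) + φ * Q′ b                  ≈⟨ +-congˡ (*-congˡ (Q′-sol b)) ⟩
        cof (suc b) + φ * (s (suc b) + T)
          ≈⟨ solve 4 (λ x f σ t → x :+ f :* (σ :+ t) := (x :+ σ :* f) :+ f :* t) refl
                     (cof (suc b)) φ (s (suc b)) T ⟩
        (cof (suc b) + s (suc b) * φ) + φ * T
          ≈⟨ +-cong (row-relation b) (*-distribˡ-∑ φ (λ k → Y′ b k * Q′ k)) ⟩
        ∑ R (λ k → Y′ b k * cof (suc k)) + ∑ R (λ k → φ * (Y′ b k * Q′ k))
          ≈⟨ ∑-+ (λ k → Y′ b k * cof (suc k)) (λ k → φ * (Y′ b k * Q′ k)) ⟨
        ∑ R (λ k → Y′ b k * cof (suc k) + φ * (Y′ b k * Q′ k))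
          ≈⟨ ∑-cong (λ k → solve 4 (λ y x f q → y :* x :+ f :* (y :* q) := y :* (x :+ f :* q)) refl
                                 (Y′ b k) (cof (suc k)) φ (Q′ k)) ⟩
        ∑ R (λ k → Y′ b k * d k)                ∎
        where
        T : Carrier
        T = ∑ R (λ k → Y′ b k * Q′ k)

    ∑-cofactors≈1 : ∀ s → ∑ R (cofactors s) ≈ 1#
    ∑-cofactors≈1 s = begin
      ∑ R (cofactors s)                ≈⟨ ∑-cong (λ j → *-identityˡ (cofactors s j)) ⟨
      ∑ R (λ j → 1# * cofactors s j)   ≈⟨ det-expand (𝟙 ∷ (I-Y+s1ᵀ s Y ∘ suc)) ⟨
      det R (𝟙 ∷ (I-Y+s1ᵀ s Y ∘ suc))
        ≈⟨ det-cong {M = 𝟙 ∷ (I-Y+s1ᵀ s Y ∘ suc)} {M′ = 𝟙 ∷ shifted}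
             (λ { zero j → refl ; (suc a) j → shift a j }) ⟩
      det R (𝟙 ∷ shifted)
        ≈⟨ det-add-multiples-of-row₀ 𝟙 (I-Y+s1ᵀ 𝟘 Y ∘ suc) (s ∘ suc) ⟩
      det R (𝟙 ∷ (I-Y+s1ᵀ 𝟘 Y ∘ suc))  ≈⟨ det-expand (𝟙 ∷ (I-Y+s1ᵀ 𝟘 Y ∘ suc)) ⟩
      ∑ R (λ j → 1# * cofactors 𝟘 j)   ≈⟨ ∑-cong (λ j → *-identityˡ (cofactors 𝟘 j)) ⟩
      cofactors 𝟘 zero + ∑ R (cofactors 𝟘 ∘ suc)
        ≈⟨ +-cong (cofactor₀ 𝟘 𝟘 𝟘-sol)
                  (∑-zero λ a → trans (cofactor-suc 𝟘 𝟘 𝟘-sol a) (trans (-‿cong (zeroʳ _)) -0#≈0#)) ⟩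
      (1# + ∑ R {m} 𝟘) + 0#            ≈⟨ trans (+-identityʳ _) (+-congˡ (∑-zero {m} {𝟘} λ _ → refl)) ⟩
      1# + 0#                          ≈⟨ +-identityʳ 1# ⟩
      1#                               ∎
      where
      𝟙 𝟘 : ∀ {k} → Row k
      𝟙 _ = 1#
      𝟘 _ = 0#
      shifted : Fin m → Row (suc m)
      shifted a j = I-Y+s1ᵀ 𝟘 Y (suc a) j + s (suc a) * 1#
      shift : ∀ a j → I-Y+s1ᵀ s Y (suc a) j ≈ shifted a j
      shift a j = solve 3 (λ x σ y → (x :+ σ) :+ y := ((x :+ con 0) :+ y) :+ σ :* con 1) refl
                    (δ (suc a) j) (s (suc a)) (- Y (suc a) j)
      𝟘-sol : Solves-I-Y (minor₀₀ Y) 𝟘 𝟘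
      𝟘-sol i = sym (trans (+-identityˡ _) (∑-zero λ j → zeroʳ (minor₀₀ Y i j)))

  det-I-Y+s1ᵀ : ∀ m → RankOneUpdateFormula m
  det-I-Y+s1ᵀ zero    s Y Q _       _     = sym (+-identityʳ 1#)
  det-I-Y+s1ᵀ (suc m) s Y Q Y-upper Q-sol = begin
    det R (I-Y+s1ᵀ s Y)                                    ≈⟨ det-expand (I-Y+s1ᵀ s Y) ⟩
    ∑ R (λ j → I-Y+s1ᵀ s Y zero j * cof j)                 ≈⟨ I-Y+s1ᵀ-apply s Y zero cof ⟩
    (cof zero + s zero * ∑ R cof) + - ∑ R (λ j → Y zero j * cof j)
      ≈⟨ +-cong (+-cong (cofactor₀ s Q′ Q′-sol) (*-congˡ (∑-cofactors≈1 s))) (-‿cong Ycof≈-P) ⟩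
    ((1# + ∑ R Q′) + s zero * 1#) + - - P                  ≈⟨ +-congˡ (-‿involutive P) ⟩
    ((1# + ∑ R Q′) + s zero * 1#) + P
      ≈⟨ solve 3 (λ S σ p → ((con 1 :+ S) :+ σ :* con 1) :+ p := con 1 :+ ((σ :+ p) :+ S)) refl
                 (∑ R Q′) (s zero) P ⟩
    1# + ((s zero + P) + ∑ R Q′)                           ≈⟨ +-congˡ (+-congʳ Q₀≈s₀+P) ⟨
    1# + ∑ R Q                                             ∎
    where
    open I-Y+s1ᵀ-Cofactors (det-I-Y+s1ᵀ m) Y Y-upper
    cof : Row (suc m)
    cof = cofactors s
    Q′ : Row m
    Q′ = Q ∘ suc
    Q′-sol : Solves-I-Y (minor₀₀ Y) (s ∘ suc) Q′
    Q′-sol = Solves-I-Y-minor₀₀ Y-upper Q-sol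
    P : Carrier
    P = ∑ R (λ b → Y zero (suc b) * Q′ b)
    cof-suc : ∀ b → cof (suc b) ≈ - Q′ b
    cof-suc b = trans (cofactor-suc s Q′ Q′-sol b)
                      (-‿cong (trans (*-congʳ (∑-cofactors≈1 s)) (*-identityˡ (Q′ b))))
    Ycof≈-P : ∑ R (λ j → Y zero j * cof j) ≈ - P
    Ycof≈-P = begin
      ∑ R (λ j → Y zero j * cof j)              ≈⟨ strictlyUpper-∑-tail Y-upper zero cof ⟩
      ∑ R (λ b → Y zero (suc b) * cof (suc b))
        ≈⟨ ∑-cong (λ b → trans (*-congˡ (cof-suc b)) (sym (-‿distribʳ-* _ _))) ⟩
      ∑ R (λ b → - (Y zero (suc b) * Q′ b))     ≈⟨ ∑-neg (λ b → Y zero (suc b) * Q′ b) ⟩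
      - P                                       ∎
    Q₀≈s₀+P : Q zero ≈ s zero + P
    Q₀≈s₀+P = trans (Q-sol zero) (+-congˡ (strictlyUpper-∑-tail Y-upper zero Q))

-- Coloured paths

module Paths {c ℓ} (R : CommutativeRing c ℓ) {n k : ℕ} (E : ColDigraph n k)
             (E-forward : ∀ i j t → E i j t ≡ true → i < j) (x : Fin n → Fin k → CommutativeRing.Carrier R) where
  open CommutativeRing R hiding (zero)
  open import Algebra.Properties.Ring ring using (-0#≈0#)
  open import Relation.Binary.Reasoning.Setoid setoid

  edgeWeight : Fin n → Fin n → Fin k → Carrier
  edgeWeight i j t = if E i j t then x i t else 0#

  s : Row R n
  s i = ∑ R (x i)

  Y : Mat R n
  Y i j = ∑ R (edgeWeight i j)

  Y-upper : StrictlyUpper R Y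
  Y-upper i j j≤i = ∑-zero R no-backward-edge
    where
    no-backward-edge : ∀ t → edgeWeight i j t ≈ 0#
    no-backward-edge t with E i j t in e
    ... | true  = ⊥-elim (ℕₚ.<⇒≱ (E-forward i j t e) j≤i)
    ... | false = refl

  A≈I-Y+s1ᵀ : ∀ i j → A R E x i j ≈ I-Y+s1ᵀ R s Y i j
  A≈I-Y+s1ᵀ i j with i ≟ j | i <? j
  ... | yes ≡.refl | _ = begin
    1# + s i                   ≈⟨ +-cong (reflexive (≡.sym (δ-diagonal R i))) (sym (+-identityʳ _)) ⟩
    δ R i i + (s i + 0#)       ≈⟨ +-congˡ (+-congˡ (trans (-‿cong (Y-upper i i Finₚ.≤-refl)) -0#≈0#)) ⟨
    δ R i i + (s i + - Y i i)  ≈⟨ +-assoc _ _ _ ⟨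
    (δ R i i + s i) + - Y i i  ∎
  ... | no i≢j | yes _ = begin
    ∑ R (λ t → if E i j t then 0# else x i t)  ≈⟨ ∑-cong R edge-removed ⟩
    ∑ R (λ t → x i t + - edgeWeight i j t)     ≈⟨ ∑-+ R (x i) (λ t → - edgeWeight i j t) ⟩
    s i + ∑ R (λ t → - edgeWeight i j t)       ≈⟨ +-congˡ (∑-neg R (edgeWeight i j)) ⟩
    s i + - Y i j                              ≈⟨ +-congʳ (+-identityˡ _) ⟨
    (0# + s i) + - Y i j                       ≡⟨ ≡.cong (λ z → (z + s i) + - Y i j) (δ-offDiagonal R i≢j) ⟨
    (δ R i j + s i) + - Y i j                  ∎
    where
    edge-removed : ∀ t → (if E i j t then 0# else x i t) ≈ x i t + - edgeWeight i j t
    edge-removed t with E i j t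
    ... | true  = sym (-‿inverseʳ _)
    ... | false = sym (trans (+-congˡ -0#≈0#) (+-identityʳ _))
  ... | no i≢j | no i≮j = begin
    s i                        ≈⟨ trans (sym (+-identityʳ _)) (+-cong (sym (+-identityˡ _)) (sym -Y≈0)) ⟩
    (0# + s i) + - Y i j       ≡⟨ ≡.cong (λ z → (z + s i) + - Y i j) (δ-offDiagonal R i≢j) ⟨
    (δ R i j + s i) + - Y i j  ∎
    where
    -Y≈0 : - Y i j ≈ 0#
    -Y≈0 = trans (-‿cong (Y-upper i j (ℕₚ.≮⇒≥ i≮j))) -0#≈0#

  paths : ℕ → Fin n → Carrier
  paths = pathsFrom R E x

  paths-suc : ∀ L i → paths (suc L) i ≈ ∑ R (λ j → Y i j * paths L j)
  paths-suc L i = begin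
    ∑ R (λ t → ∑ R (λ j → if E i j t then x i t * paths L j else 0#))
      ≈⟨ ∑-swap R (λ t j → if E i j t then x i t * paths L j else 0#) ⟩
    ∑ R (λ j → ∑ R (λ t → if E i j t then x i t * paths L j else 0#))
      ≈⟨ ∑-cong R (λ j → ∑-cong R (edge-term j)) ⟩
    ∑ R (λ j → ∑ R (λ t → edgeWeight i j t * paths L j))
      ≈⟨ ∑-cong R (λ j → sym (*-distribʳ-∑ R (paths L j) (edgeWeight i j))) ⟩
    ∑ R (λ j → Y i j * paths L j)                                      ∎
    where
    edge-term : ∀ j t → (if E i j t then x i t * paths L j else 0#) ≈ edgeWeight i j t * paths L j
    edge-term j t with E i j t
    ... | true  = refl
    ... | false = sym (zeroˡ _)

  paths-too-long : ∀ L i → n ≤ toℕ i ℕ.+ L → paths L i ≈ 0#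
  paths-too-long zero    i n≤i+0 =
    ⊥-elim (ℕₚ.<⇒≱ (Finₚ.toℕ<n i) (≡.subst (n ≤_) (ℕₚ.+-identityʳ (toℕ i)) n≤i+0))
  paths-too-long (suc L) i n≤i+L+1 = ∑-zero R λ t → ∑-zero R (path-term t)
    where
    path-term : ∀ t j → (if E i j t then x i t * paths L j else 0#) ≈ 0#
    path-term t j with E i j t in e
    ... | true  = trans (*-congˡ (paths-too-long L j n≤j+L)) (zeroʳ _)
      where
      n≤j+L : n ≤ toℕ j ℕ.+ L
      n≤j+L = ℕₚ.≤-trans n≤i+L+1
        (≡.subst (_≤ toℕ j ℕ.+ L) (≡.sym (ℕₚ.+-suc (toℕ i) L)) (ℕₚ.+-monoˡ-≤ L (E-forward i j t e)))
    ... | false = refl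

  Q : Fin n → Carrier
  Q i = ∑ R {n} (λ L → paths (toℕ L) i)

  Q-solves : Solves-I-Y R Y s Q
  Q-solves i = sym (begin
    s i + ∑ R (λ j → Y i j * ∑ R {n} (λ L → paths (toℕ L) j))
      ≈⟨ +-congˡ (∑-cong R (λ j → *-distribˡ-∑ R {n} (Y i j) (λ L → paths (toℕ L) j))) ⟩
    s i + ∑ R (λ j → ∑ R {n} (λ L → Y i j * paths (toℕ L) j))
      ≈⟨ +-congˡ (∑-swap R (λ j (L : Fin n) → Y i j * paths (toℕ L) j)) ⟩
    s i + ∑ R {n} (λ L → ∑ R (λ j → Y i j * paths (toℕ L) j))
      ≈⟨ +-congˡ (∑-cong R {n} (λ L → paths-suc (toℕ L) i)) ⟨
    ∑ R {suc n} (λ L → paths (toℕ L) i)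
      ≈⟨ ∑-init-last R {n} (λ L → paths (toℕ L) i) ⟩
    ∑ R {n} (λ L → paths (toℕ (inject₁ L)) i) + paths (toℕ (fromℕ n)) i
      ≈⟨ +-cong (∑-cong R {n} (λ L → reflexive (≡.cong (λ l → paths l i) (Finₚ.toℕ-inject₁ L))))
                (trans (reflexive (≡.cong (λ l → paths l i) (Finₚ.toℕ-fromℕ n)))
                       (paths-too-long n i (ℕₚ.m≤n+m n (toℕ i)))) ⟩
    Q i + 0#                                   ≈⟨ +-identityʳ _ ⟩
    Q i                                        ∎)

  pathTotal≈1+∑Q : pathTotal R E x ≈ 1# + ∑ R Q
  pathTotal≈1+∑Q = +-congˡ (∑-swap R λ (L : Fin n) i → paths (toℕ L) i)

theorem2p4 : ∀ {c ℓ} (R : CommutativeRing c ℓ) (k n : ℕ) → 1 ≤ k → 1 ≤ n →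
    (E : ColDigraph n k) → (∀ i j t → E i j t ≡ true → i < j) →
    (x : Fin n → Fin k → CommutativeRing.Carrier R) →
    CommutativeRing._≈_ R (det R (A R E x)) (pathTotal R E x)
theorem2p4 R k n _ _ E E-forward x = begin
  det R (A R E x)        ≈⟨ det-cong R A≈I-Y+s1ᵀ ⟩
  det R (I-Y+s1ᵀ R s Y)  ≈⟨ det-I-Y+s1ᵀ R n s Y Q Y-upper Q-solves ⟩
  1# + ∑ R Q             ≈⟨ pathTotal≈1+∑Q ⟨
  pathTotal R E x        ∎
  where
  open CommutativeRing R
  open import Relation.Binary.Reasoning.Setoid setoid
  open Paths R E E-forward x
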